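{- Consider the following procedure DetectSingleCycle on a set of edges $E'$ (of some graph), with access to an independence oracle $\mathrm{Ind}$: if $\mathrm{Ind}(E')=1$, return $\perp$; otherwise, let $S=\{e\in E':\mathrm{Ind}(E'\setminus\{e\})=1\}$; if $S=\emptyset$ return $\perp$, else return $S$. Then this procedure makes $|E'|+1$ queries to $\mathrm{Ind}$, all in a single non-adaptive round, and it returns $\perp$ if $E'$ contains no cycle or at least two distinct cycles, and otherwise (if $E'$ contains exactly one cycle) returns a set $S\subseteq E'$ that is exactly the set of edges of the unique cycle in $E'$.
   Context: $\mathrm{Ind}(T)=1$ if the edge set $T$ contains no cycle and $\mathrm{Ind}(T)=0$ otherwise. A cycle is identified with its edge set. -}

module Defs where

open import Data.Nat using (ℕ; zero; suc; _+_)
open import Data.Nat.DivMod using (_mod_)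
open import Data.Fin using (Fin; toℕ; _<_)
open import Data.Fin.Properties using (_≟_)
open import Data.Bool using (Bool; true; false; if_then_else_)
open import Data.List using (List; []; _∷_; map; filter; length)
open import Data.List.Membership.Propositional using (_∈_)
open import Data.List.Relation.Unary.All using (All)
open import Data.List.Relation.Unary.Unique.Propositional using (Unique)
open import Data.Maybe using (Maybe; just; nothing)
open import Data.Product using (Σ; _×_; _,_; ∃; ∃-syntax)
open import Data.Product.Properties using (≡-dec)
open import Data.Sum using (_⊎_)
open import Function using (Injective; _⇔_)
open import Relation.Binary.PropositionalEquality using (_≡_; _≢_)
open import Relation.Nullary using (¬_; Dec; yes; no)
open import Relation.Nullary.Decidable using (¬?)

-- Edges of a simple graph on vertex set Fin n.
-- An edge {u,v} (u ≠ v) is stored canonically as the pair (u , v) with u < v.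

Edge : ℕ → Set
Edge n = Fin n × Fin n

-- an edge set is a list of edges; set-theoretic notions are via _∈_
EdgeSet : ℕ → Set
EdgeSet n = List (Edge n)

IsSimpleEdgeSet : ∀ {n} → EdgeSet n → Set
IsSimpleEdgeSet E = All (λ e → Data.Product.proj₁ e < Data.Product.proj₂ e) E × Unique E

_⊆_ : ∀ {n} → EdgeSet n → EdgeSet n → Set
A ⊆ B = ∀ {e} → e ∈ A → e ∈ B

_≐_ : ∀ {n} → EdgeSet n → EdgeSet n → Set
A ≐ B = A ⊆ B × B ⊆ A

next : ∀ {m} → Fin (suc m) → Fin (suc m)
next {m} i = suc (toℕ i) mod (suc m)

IsCycle : ∀ {n} → EdgeSet n → Set
IsCycle {n} C =
  Σ ℕ λ k → Σ (Fin (3 + k) → Fin n) λ v → Injective _≡_ _≡_ v ×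
    (∀ a b → ((a , b) ∈ C) ⇔
       (a < b × ∃[ i ] ((v i ≡ a × v (next i) ≡ b) ⊎ (v i ≡ b × v (next i) ≡ a))))

HasCycle : ∀ {n} → EdgeSet n → Set
HasCycle T = ∃[ C ] (IsCycle C × C ⊆ T)

HasTwoCycles : ∀ {n} → EdgeSet n → Set
HasTwoCycles T = ∃[ C ] ∃[ D ] (IsCycle C × C ⊆ T × IsCycle D × D ⊆ T × ¬ (C ≐ D))

UniqueCycle : ∀ {n} → EdgeSet n → EdgeSet n → Set
UniqueCycle T C = IsCycle C × C ⊆ T × (∀ D → IsCycle D → D ⊆ T → D ≐ C)

IsIndOracle : ∀ {n} → (EdgeSet n → Bool) → Set
IsIndOracle {n} ind = ∀ (T : EdgeSet n) → (ind T ≡ true) ⇔ (¬ HasCycle T)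

-- The procedure DetectSingleCycle, as a non-adaptive query algorithm:
-- the list of queries depends only on E' (one round), and the output
-- is a function of E' and the list of oracle answers.

remove : ∀ {n} → Edge n → EdgeSet n → EdgeSet n
remove {n} e E = filter (λ f → ¬? (≡-dec _≟_ _≟_ f e)) E

queries : ∀ {n} → EdgeSet n → List (EdgeSet n)
queries E = E ∷ map (λ e → remove e E) E

collect : ∀ {n} → EdgeSet n → List Bool → EdgeSet n
collect (e ∷ es) (true ∷ bs) = e ∷ collect es bs
collect (e ∷ es) (false ∷ bs) = collect es bs
collect _ _ = []

nonEmpty : ∀ {n} → EdgeSet n → Maybe (EdgeSet n)
nonEmpty [] = nothing
nonEmpty (e ∷ es) = just (e ∷ es)

-- nothing plays the role of ⊥
decide : ∀ {n} → EdgeSet n → List Bool → Maybe (EdgeSet n)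
decide E [] = nothing
decide E (true ∷ bs) = nothing
decide E (false ∷ bs) = nonEmpty (collect E bs)

detectSingleCycle : ∀ {n} → (EdgeSet n → Bool) → EdgeSet n → Maybe (EdgeSet n)
detectSingleCycle ind E = decide E (map ind (queries E))

{-# OPTIONS --safe #-}
-- Ind(E ∖ {e}) = 1 exactly when e lies on every cycle contained in E, so if E
-- has a unique cycle C the returned set S is the edge set of C.  If E contains
-- two distinct cycles C and D, no edge lies on every cycle: an edge outside C
-- (or D) is avoided by C (or D), and an edge of C ∩ D is avoided by the
-- symmetric difference of C and D.  That difference is nonempty, and since
-- every vertex has degree two in C and in D, none of its vertices has degree
-- one; a non-backtracking walk inside it must revisit a vertex, which closes
-- a cycle.
module Submission where

open import Level using (Level; 0ℓ)
open import Data.Bool using (Bool; true; false)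
open import Data.Bool.Properties using (¬-not)
open import Data.Empty using (⊥-elim)
open import Data.Fin using (Fin; zero; suc; toℕ; fromℕ; inject₁; _<_; _<?_)
open import Data.Fin.Properties
  using ( toℕ-injective; toℕ-fromℕ; toℕ-fromℕ<; toℕ-inject₁; toℕ<n; toℕ≤pred[n]
        ; fromℕ≢inject₁; 0≢1+n; <-cmp; <-irrefl; <-asym; pigeonhole; any?; _≟_)
open import Data.Fin.Relation.Unary.Top using (view; ‵fromℕ; ‵inject₁)
open import Data.List using (List; []; _∷_; length; map; filter; allFin; cartesianProduct)
open import Data.List.Properties using (length-map; map-∘)
open import Data.List.Membership.Propositional using (_∈_; _∉_)
open import Data.List.Membership.Propositional.Properties
  using (∈-filter⁺; ∈-filter⁻; ∈-allFin; ∈-cartesianProduct⁺)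
import Data.List.Membership.DecPropositional as DecMembership
open import Data.List.Relation.Unary.Any using (here; there)
open import Data.Maybe using (just; nothing)
open import Data.Nat using (ℕ; suc; _+_; _∸_; _≤_; z≤n; s≤s; s≤s⁻¹)
open import Data.Nat.DivMod using (_%_; m<n⇒m%n≡m; n%n≡0)
open import Data.Nat.Properties
  using (1+n≢n; m≢1+n+m; n<1+n; m≤n⇒m<n∨m≡n; m∸n+n≡m; +-cancelʳ-≡; +-monoˡ-≤; <⇒≢; anyUpTo?)
open import Data.Product using (Σ; _×_; _,_; proj₁; proj₂; ∃-syntax; map₁; map₂)
open import Data.Product.Properties using (≡-dec)
open import Data.Sum using (_⊎_; inj₁; inj₂; [_,_]) renaming (swap to ⊎-swap)
open import Function using (_∘_; _⇔_; Injective; mk⇔; Equivalence)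
open import Relation.Binary.Core using (Rel)
open import Relation.Binary.Definitions using (Symmetric; Irreflexive; Decidable; tri<; tri≈; tri>)
open import Relation.Binary.PropositionalEquality
  using (_≡_; _≢_; refl; sym; trans; cong; subst; subst₂; ≢-sym; module ≡-Reasoning)
open import Relation.Nullary using (¬_; Dec; yes; no)
open import Relation.Nullary.Decidable using (¬?; _×-dec_; _⊎-dec_)

open import Defs

open Equivalence

private
  variable
    ℓ : Level
    n m : ℕ

module _ {m : ℕ} where

  toℕ-next : (i : Fin (suc m)) → toℕ (next i) ≡ suc (toℕ i) % suc m
  toℕ-next i = toℕ-fromℕ< _

  next-fromℕ : next (fromℕ m) ≡ zero
  next-fromℕ = toℕ-injective (begin
    toℕ (next (fromℕ m))        ≡⟨ toℕ-next (fromℕ m) ⟩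
    suc (toℕ (fromℕ m)) % suc m ≡⟨ cong (λ t → suc t % suc m) (toℕ-fromℕ m) ⟩
    suc m % suc m               ≡⟨ n%n≡0 (suc m) ⟩
    0                           ∎)
    where open ≡-Reasoning

  next-inject₁ : (j : Fin m) → next (inject₁ j) ≡ suc j
  next-inject₁ j = toℕ-injective (begin
    toℕ (next (inject₁ j))        ≡⟨ toℕ-next (inject₁ j) ⟩
    suc (toℕ (inject₁ j)) % suc m ≡⟨ cong (λ t → suc t % suc m) (toℕ-inject₁ j) ⟩
    suc (toℕ j) % suc m           ≡⟨ m<n⇒m%n≡m (s≤s (toℕ<n j)) ⟩
    suc (toℕ j)                   ∎)
    where open ≡-Reasoning

  prev : Fin (suc m) → Fin (suc m)
  prev zero    = fromℕ m
  prev (suc j) = inject₁ j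

  next-prev : (i : Fin (suc m)) → next (prev i) ≡ i
  next-prev zero    = next-fromℕ
  next-prev (suc j) = next-inject₁ j

  prev-next : (i : Fin (suc m)) → prev (next i) ≡ i
  prev-next i with view i
  ... | ‵fromℕ     = cong prev next-fromℕ
  ... | ‵inject₁ j = cong prev (next-inject₁ j)

next≢id : (i : Fin (2 + m)) → next i ≢ i
next≢id i with view i
... | ‵fromℕ     = λ eq → fromℕ≢inject₁ (trans (sym eq) next-fromℕ)
... | ‵inject₁ j = λ eq → 1+n≢n (begin
  suc (toℕ j)            ≡⟨ cong toℕ (sym (next-inject₁ j)) ⟩
  toℕ (next (inject₁ j)) ≡⟨ cong toℕ eq ⟩
  toℕ (inject₁ j)        ≡⟨ toℕ-inject₁ j ⟩
  toℕ j                  ∎)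
  where open ≡-Reasoning

next∘next≢id : (i : Fin (3 + m)) → next (next i) ≢ i
next∘next≢id i with view i
... | ‵fromℕ = λ eq →
  fromℕ≢inject₁ (trans (sym eq) (trans (cong next next-fromℕ) (next-inject₁ zero)))
... | ‵inject₁ j with view j
...   | ‵fromℕ = λ eq →
  0≢1+n (trans (sym next-fromℕ) (trans (sym (cong next (next-inject₁ j))) eq))
...   | ‵inject₁ j′ = λ eq → m≢1+n+m (toℕ j′) (begin
  toℕ j′                                   ≡⟨ sym (trans (toℕ-inject₁ _) (toℕ-inject₁ j′)) ⟩
  toℕ (inject₁ (inject₁ j′))               ≡⟨ cong toℕ (sym eq) ⟩
  toℕ (next (next (inject₁ (inject₁ j′)))) ≡⟨ cong (toℕ ∘ next) (next-inject₁ (inject₁ j′)) ⟩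
  toℕ (next (inject₁ (suc j′)))            ≡⟨ cong toℕ (next-inject₁ (suc j′)) ⟩
  2 + toℕ j′                               ∎)
  where open ≡-Reasoning

Leafless : Rel (Fin n) ℓ → Set ℓ
Leafless R = ∀ {x y} → R x y → ∃[ z ] (z ≢ y × R x z)

DegreeTwo : Rel (Fin n) ℓ → Set ℓ
DegreeTwo R = ∀ {x y} → R x y →
  ∃[ y′ ] (y′ ≢ y × R x y′ × (∀ {z} → R x z → z ≡ y ⊎ z ≡ y′))

SymDiff : Rel (Fin n) ℓ → Rel (Fin n) ℓ → Rel (Fin n) ℓ
SymDiff R S x y = (R x y × ¬ S x y) ⊎ (S x y × ¬ R x y)

record NonBacktrackingWalk (R : Rel (Fin n) ℓ) : Set ℓ where
  field
    vertex          : ℕ → Fin n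
    adjacent        : ∀ i → R (vertex i) (vertex (suc i))
    nonBacktracking : ∀ i → vertex (2 + i) ≢ vertex i

record CycleIn (R : Rel (Fin n) ℓ) : Set ℓ where
  field
    {k}       : ℕ
    vertex    : Fin (3 + k) → Fin n
    injective : Injective _≡_ _≡_ vertex
    adjacent  : ∀ t → R (vertex t) (vertex (next t))

module _ {R S : Rel (Fin n) ℓ} where

  symDiff-sym : Symmetric R → Symmetric S → Symmetric (SymDiff R S)
  symDiff-sym R-sym S-sym (inj₁ (r , ¬s)) = inj₁ (R-sym r , ¬s ∘ S-sym)
  symDiff-sym R-sym S-sym (inj₂ (s , ¬r)) = inj₂ (S-sym s , ¬r ∘ R-sym)

  symDiff-irrefl : Irreflexive _≡_ R → Irreflexive _≡_ S → Irreflexive _≡_ (SymDiff R S)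
  symDiff-irrefl R-irrefl S-irrefl eq (inj₁ (r , _)) = R-irrefl eq r
  symDiff-irrefl R-irrefl S-irrefl eq (inj₂ (s , _)) = S-irrefl eq s

-- If R's other edge x y′ at x lies in S, then S's other edge x y″ is not in R:
-- y″ differs from y′, and from y because x y ∉ S.
symDiff-leafless-half : {R S : Rel (Fin n) ℓ} → Decidable R → Decidable S →
  DegreeTwo R → DegreeTwo S →
  ∀ {x y} → R x y → ¬ S x y → ∃[ z ] (z ≢ y × SymDiff R S x z)
symDiff-leafless-half R? S? R-deg S-deg {x = x} r ¬s with R-deg r
... | y′ , y′≢y , r′ , R-unique with S? x y′
...   | no ¬s′ = y′ , y′≢y , inj₁ (r′ , ¬s′)
...   | yes s′ with S-deg s′
...     | y″ , y″≢y′ , s″ , _ with R? x y″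
...       | no ¬r″ = y″ , (λ { refl → ¬s s″ }) , inj₂ (s″ , ¬r″)
...       | yes r″ with R-unique r″
...         | inj₁ refl  = ⊥-elim (¬s s″)
...         | inj₂ y″≡y′ = ⊥-elim (y″≢y′ y″≡y′)

symDiff-leafless : {R S : Rel (Fin n) ℓ} → Decidable R → Decidable S →
  DegreeTwo R → DegreeTwo S → Leafless (SymDiff R S)
symDiff-leafless R? S? R-deg S-deg (inj₁ (r , ¬s)) =
  symDiff-leafless-half R? S? R-deg S-deg r ¬s
symDiff-leafless R? S? R-deg S-deg (inj₂ (s , ¬r)) =
  map₂ (map₂ ⊎-swap) (symDiff-leafless-half S? R? S-deg R-deg s ¬r)

leafless⇒walk : {R : Rel (Fin n) ℓ} → Symmetric R → Leafless R →
  ∀ {x y} → R x y → NonBacktrackingWalk R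
leafless⇒walk {n = n} {R = R} R-sym leafless {x} {y} r = record
  { vertex          = proj₁ ∘ proj₁ ∘ arc
  ; adjacent        = proj₂ ∘ arc
  ; nonBacktracking = λ i → proj₁ (proj₂ (leafless (R-sym (proj₂ (arc i)))))
  }
  where
  Arc : Set _
  Arc = Σ (Fin n × Fin n) λ (u , v) → R u v

  continue : Arc → Arc
  continue ((u , v) , r) = let (w , _ , r′) = leafless (R-sym r) in (v , w) , r′

  arc : ℕ → Arc
  arc 0       = (x , y) , r
  arc (suc i) = continue (arc i)

module _ {R : Rel (Fin n) ℓ} (R-irrefl : Irreflexive _≡_ R) (W : NonBacktrackingWalk R) where
  open NonBacktrackingWalk W

  InjectiveUpTo : ℕ → Set
  InjectiveUpTo j = ∀ {a b} → a ≤ j → b ≤ j → vertex a ≡ vertex b → a ≡ b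

  record Return : Set where
    field
      start len : ℕ
      injective : InjectiveUpTo (len + start)
      closes    : vertex (suc (len + start)) ≡ vertex start

  return⇒cycle : Return → CycleIn R
  return⇒cycle record { start = s ; len = 0 ; closes = closes } =
    ⊥-elim (R-irrefl (sym closes) (adjacent s))
  return⇒cycle record { start = s ; len = 1 ; closes = closes } =
    ⊥-elim (nonBacktracking s closes)
  return⇒cycle record { start = s ; len = suc (suc k) ; injective = inj ; closes = closes } =
    record { vertex = v ; injective = v-injective ; adjacent = v-adjacent }
    where
    -- Offsets are added on the left so that v zero and v (suc j) compute.
    v : Fin (3 + k) → Fin n
    v t = vertex (toℕ t + s)

    v-injective : Injective _≡_ _≡_ v
    v-injective {t} {t′} eq = toℕ-injective (+-cancelʳ-≡ s _ _
      (inj (+-monoˡ-≤ s (toℕ≤pred[n] t)) (+-monoˡ-≤ s (toℕ≤pred[n] t′)) eq))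

    v-adjacent : ∀ t → R (v t) (v (next t))
    v-adjacent t with view t
    ... | ‵fromℕ = subst₂ R
      (cong (λ a → vertex (a + s)) (sym (toℕ-fromℕ _)))
      (trans closes (cong v (sym next-fromℕ)))
      (adjacent (suc (suc k) + s))
    ... | ‵inject₁ j = subst₂ R
      (cong (λ a → vertex (a + s)) (sym (toℕ-inject₁ j)))
      (cong v (sym (next-inject₁ j)))
      (adjacent (toℕ j + s))

  returnAt : ∀ {s j} → s ≤ j → InjectiveUpTo j → vertex s ≡ vertex (suc j) → Return
  returnAt {s} {j} s≤j inj eq = record
    { start     = s
    ; len       = j ∸ s
    ; injective = subst InjectiveUpTo (sym j∸s+s≡j) inj
    ; closes    = subst (λ t → vertex (suc t) ≡ vertex s) (sym j∸s+s≡j) (sym eq)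
    }
    where
    j∸s+s≡j : j ∸ s + s ≡ j
    j∸s+s≡j = m∸n+n≡m s≤j

  injectiveUpTo-suc : ∀ {j} → InjectiveUpTo j →
    (∀ {a} → a ≤ j → vertex a ≢ vertex (suc j)) → InjectiveUpTo (suc j)
  injectiveUpTo-suc inj fresh a≤ b≤ eq with m≤n⇒m<n∨m≡n a≤ | m≤n⇒m<n∨m≡n b≤
  ... | inj₁ a< | inj₁ b<       = inj (s≤s⁻¹ a<) (s≤s⁻¹ b<) eq
  ... | inj₁ a< | inj₂ refl     = ⊥-elim (fresh (s≤s⁻¹ a<) eq)
  ... | inj₂ refl | inj₁ b<     = ⊥-elim (fresh (s≤s⁻¹ b<) (sym eq))
  ... | inj₂ refl | inj₂ refl   = refl

  firstReturn : ∀ j → InjectiveUpTo j ⊎ Return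
  firstReturn 0 = inj₁ λ { z≤n z≤n _ → refl }
  firstReturn (suc j) with firstReturn j
  ... | inj₂ ret = inj₂ ret
  ... | inj₁ inj with anyUpTo? (λ a → vertex a ≟ vertex (suc j)) (suc j)
  ...   | yes (a , a<1+j , eq) = inj₂ (returnAt (s≤s⁻¹ a<1+j) inj eq)
  ...   | no none = inj₁ (injectiveUpTo-suc inj λ a≤j eq → none (_ , s≤s a≤j , eq))

  walk⇒cycle : CycleIn R
  walk⇒cycle with firstReturn n
  ... | inj₂ ret = return⇒cycle ret
  ... | inj₁ inj =
    let (i , j , i<j , eq) = pigeonhole (n<1+n n) (vertex ∘ toℕ)
    in ⊥-elim (<⇒≢ i<j (inj (toℕ≤pred[n] i) (toℕ≤pred[n] j) eq))

leafless⇒cycle : {R : Rel (Fin n) ℓ} → Symmetric R → Irreflexive _≡_ R → Leafless R →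
  ∀ {x y} → R x y → CycleIn R
leafless⇒cycle R-sym R-irrefl leafless r =
  walk⇒cycle R-irrefl (leafless⇒walk R-sym leafless r)

_∈?_ : (e : Edge n) (E : EdgeSet n) → Dec (e ∈ E)
_∈?_ = DecMembership._∈?_ (≡-dec _≟_ _≟_)

Link : EdgeSet n → Rel (Fin n) 0ℓ
Link C x y = (x , y) ∈ C ⊎ (y , x) ∈ C

Ordered : EdgeSet n → Set
Ordered C = ∀ {a b} → (a , b) ∈ C → a < b

module _ {C : EdgeSet n} where

  link-sym : Symmetric (Link C)
  link-sym = ⊎-swap

  link? : Decidable (Link C)
  link? x y = ((x , y) ∈? C) ⊎-dec ((y , x) ∈? C)

  link-irrefl : Ordered C → Irreflexive _≡_ (Link C)
  link-irrefl ordered refl (inj₁ h) = <-irrefl refl (ordered h)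
  link-irrefl ordered refl (inj₂ h) = <-irrefl refl (ordered h)

  link⇒∈ : Ordered C → ∀ {a b} → a < b → Link C a b → (a , b) ∈ C
  link⇒∈ ordered a<b (inj₁ h) = h
  link⇒∈ ordered a<b (inj₂ h) = ⊥-elim (<-asym a<b (ordered h))

EdgeAt : {k : ℕ} → (Fin (3 + k) → Fin n) → Fin (3 + k) → Fin n → Fin n → Set
EdgeAt v i a b = (v i ≡ a × v (next i) ≡ b) ⊎ (v i ≡ b × v (next i) ≡ a)

cycle-ordered : {C : EdgeSet n} → IsCycle C → Ordered C
cycle-ordered (_ , _ , _ , char) h = proj₁ (to (char _ _) h)

module CycleStructure {C : EdgeSet n} {k : ℕ} {v : Fin (3 + k) → Fin n}
  (v-injective : Injective _≡_ _≡_ v)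
  (char : ∀ a b → ((a , b) ∈ C) ⇔ (a < b × ∃[ i ] EdgeAt v i a b)) where

  edgeAt⇒link : ∀ {i x y} → EdgeAt v i x y → Link C x y
  edgeAt⇒link {i} {x} {y} e with <-cmp x y
  ... | tri< x<y _ _ = inj₁ (from (char x y) (x<y , i , e))
  ... | tri> _ _ y<x = inj₂ (from (char y x) (y<x , i , ⊎-swap e))
  ... | tri≈ _ refl _ = ⊥-elim (next≢id i (v-injective ([ loop , loop ] e)))
    where
    loop : v i ≡ x × v (next i) ≡ x → v (next i) ≡ v i
    loop (p , q) = trans q (sym p)

  link⇒edgeAt : ∀ {x y} → Link C x y → ∃[ i ] EdgeAt v i x y
  link⇒edgeAt {x} {y} (inj₁ h) = proj₂ (to (char x y) h)
  link⇒edgeAt {x} {y} (inj₂ h) = map₂ ⊎-swap (proj₂ (to (char y x) h))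

  on-cycle : ∀ {x y} → Link C x y → ∃[ j ] v j ≡ x
  on-cycle l with link⇒edgeAt l
  ... | i , inj₁ (vi≡x , _) = i , vi≡x
  ... | i , inj₂ (_ , vni≡x) = next i , vni≡x

  link-next : ∀ j → Link C (v j) (v (next j))
  link-next j = edgeAt⇒link (inj₁ (refl , refl))

  link-prev : ∀ j → Link C (v j) (v (prev j))
  link-prev j = edgeAt⇒link {i = prev j} (inj₂ (refl , cong v (next-prev j)))

  next≢prev : ∀ j → v (next j) ≢ v (prev j)
  next≢prev j eq = next∘next≢id j (trans (cong next (v-injective eq)) (next-prev j))

  neighbours : ∀ j {z} → Link C (v j) z → z ≡ v (next j) ⊎ z ≡ v (prev j)
  neighbours j l with link⇒edgeAt l
  ... | i , inj₁ (vi≡vj , vni≡z) =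
    inj₁ (trans (sym vni≡z) (cong (v ∘ next) (v-injective vi≡vj)))
  ... | i , inj₂ (vi≡z , vni≡vj) =
    inj₂ (trans (sym vi≡z) (cong v i≡prev))
    where
    i≡prev : i ≡ prev j
    i≡prev = trans (sym (prev-next i)) (cong prev (v-injective vni≡vj))

  degreeTwo : DegreeTwo (Link C)
  degreeTwo l with on-cycle l
  ... | j , refl with neighbours j l
  ...   | inj₁ refl = v (prev j) , ≢-sym (next≢prev j) , link-prev j , neighbours j
  ...   | inj₂ refl = v (next j) , next≢prev j , link-next j , ⊎-swap ∘ neighbours j

cycle-degreeTwo : {C : EdgeSet n} → IsCycle C → DegreeTwo (Link C)
cycle-degreeTwo (_ , _ , inj , char) = CycleStructure.degreeTwo inj char

cycle-nonempty : {C : EdgeSet n} → IsCycle C → ∃[ e ] e ∈ C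
cycle-nonempty (_ , _ , inj , char) with CycleStructure.link-next inj char zero
... | inj₁ h = _ , h
... | inj₂ h = _ , h

allPairs : EdgeSet n
allPairs {n} = cartesianProduct (allFin n) (allFin n)

module _ {k : ℕ} (v : Fin (3 + k) → Fin n) where

  IsEdgeOf : Edge n → Set
  IsEdgeOf (a , b) = a < b × ∃[ i ] EdgeAt v i a b

  isEdgeOf? : ∀ e → Dec (IsEdgeOf e)
  isEdgeOf? (a , b) = (a <? b) ×-dec any? λ i →
    ((v i ≟ a) ×-dec (v (next i) ≟ b)) ⊎-dec ((v i ≟ b) ×-dec (v (next i) ≟ a))

  edgesOf : EdgeSet n
  edgesOf = filter isEdgeOf? allPairs

  edgesOf-isCycle : Injective _≡_ _≡_ v → IsCycle edgesOf
  edgesOf-isCycle v-injective = k , v , v-injective , λ a b → mk⇔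
    (proj₂ ∘ ∈-filter⁻ isEdgeOf? {xs = allPairs})
    (∈-filter⁺ isEdgeOf? (∈-cartesianProduct⁺ (∈-allFin a) (∈-allFin b)))

∈-edgesOf⁻ : {R : Rel (Fin n) ℓ} → Symmetric R → (c : CycleIn R) →
  ∀ {a b} → (a , b) ∈ edgesOf (CycleIn.vertex c) → a < b × R a b
∈-edgesOf⁻ R-sym c h with proj₂ (∈-filter⁻ (isEdgeOf? (CycleIn.vertex c)) {xs = allPairs} h)
... | a<b , i , inj₁ (refl , refl) = a<b , CycleIn.adjacent c i
... | a<b , i , inj₂ (refl , refl) = a<b , R-sym (CycleIn.adjacent c i)

∈-remove⁺ : ∀ {f} e {E : EdgeSet n} → f ∈ E → f ≢ e → f ∈ remove e E
∈-remove⁺ e = ∈-filter⁺ (λ f → ¬? (≡-dec _≟_ _≟_ f e))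

∈-remove⁻ : ∀ {f} e (E : EdgeSet n) → f ∈ remove e E → f ∈ E × f ≢ e
∈-remove⁻ e E = ∈-filter⁻ (λ f → ¬? (≡-dec _≟_ _≟_ f e)) {xs = E}

hasCycle-remove : ∀ {E C : EdgeSet n} {e} → IsCycle C → C ⊆ E → e ∉ C → HasCycle (remove e E)
hasCycle-remove {C = C} {e} C-cycle C⊆E e∉C =
  C , C-cycle , λ h → ∈-remove⁺ e (C⊆E h) λ eq → e∉C (subst (_∈ C) eq h)

⊆-or-witness : (C D : EdgeSet n) → C ⊆ D ⊎ ∃[ f ] (f ∈ C × f ∉ D)
⊆-or-witness []      D = inj₁ λ ()
⊆-or-witness (f ∷ C) D with f ∈? D | ⊆-or-witness C D
... | no f∉D  | _                     = inj₂ (f , here refl , f∉D)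
... | yes _   | inj₂ (g , g∈C , g∉D)  = inj₂ (g , there g∈C , g∉D)
... | yes f∈D | inj₁ C⊆D              = inj₁ λ { (here refl) → f∈D ; (there g∈C) → C⊆D g∈C }

-- The symmetric difference of the two cycles contains a cycle, and it avoids e.
hasCycle-remove-shared : ∀ {E C D : EdgeSet n} {e f} →
  IsCycle C → C ⊆ E → IsCycle D → D ⊆ E →
  e ∈ C → e ∈ D → f ∈ C → f ∉ D → HasCycle (remove e E)
hasCycle-remove-shared {n = n} {E} {C} {D} {e} {a , b}
  C-cycle C⊆E D-cycle D⊆E e∈C e∈D f∈C f∉D =
  edgesOf vertex , edgesOf-isCycle vertex injective , edges⊆
  where
  Diff : Rel (Fin n) 0ℓ
  Diff = SymDiff (Link C) (Link D)

  Diff-sym : Symmetric Diff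
  Diff-sym = symDiff-sym {R = Link C} {S = Link D} (link-sym {C = C}) (link-sym {C = D})

  a<b : a < b
  a<b = cycle-ordered C-cycle f∈C

  cycle : CycleIn Diff
  cycle = leafless⇒cycle Diff-sym
    (symDiff-irrefl {R = Link C} {S = Link D}
      (link-irrefl (cycle-ordered C-cycle)) (link-irrefl (cycle-ordered D-cycle)))
    (symDiff-leafless {R = Link C} {S = Link D}
      link? link? (cycle-degreeTwo C-cycle) (cycle-degreeTwo D-cycle))
    (inj₁ (inj₁ f∈C , f∉D ∘ link⇒∈ (cycle-ordered D-cycle) a<b))
  open CycleIn cycle

  edges⊆ : edgesOf vertex ⊆ remove e E
  edges⊆ {a′ , b′} h with ∈-edgesOf⁻ Diff-sym cycle h
  ... | a′<b′ , inj₁ (inC , ¬inD) =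
    ∈-remove⁺ e (C⊆E (link⇒∈ (cycle-ordered C-cycle) a′<b′ inC))
      λ eq → ¬inD (inj₁ (subst (_∈ D) (sym eq) e∈D))
  ... | a′<b′ , inj₂ (inD , ¬inC) =
    ∈-remove⁺ e (D⊆E (link⇒∈ (cycle-ordered D-cycle) a′<b′ inD))
      λ eq → ¬inC (inj₁ (subst (_∈ C) (sym eq) e∈C))

hasTwoCycles⇒hasCycle-remove : ∀ {E : EdgeSet n} → HasTwoCycles E → ∀ e → HasCycle (remove e E)
hasTwoCycles⇒hasCycle-remove (C , D , C-cycle , C⊆E , D-cycle , D⊆E , C≉D) e
  with e ∈? C | e ∈? D
... | no e∉C  | _       = hasCycle-remove C-cycle C⊆E e∉C
... | yes _   | no e∉D  = hasCycle-remove D-cycle D⊆E e∉D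
... | yes e∈C | yes e∈D with ⊆-or-witness C D | ⊆-or-witness D C
...   | inj₁ C⊆D | inj₁ D⊆C = ⊥-elim (C≉D (C⊆D , D⊆C))
...   | inj₂ (_ , f∈C , f∉D) | _ =
  hasCycle-remove-shared C-cycle C⊆E D-cycle D⊆E e∈C e∈D f∈C f∉D
...   | inj₁ _ | inj₂ (_ , f∈D , f∉C) =
  hasCycle-remove-shared D-cycle D⊆E C-cycle C⊆E e∈D e∈C f∈D f∉C

uniqueCycle⇒acyclic-remove⇔∈ : ∀ {E C : EdgeSet n} → UniqueCycle E C →
  ∀ e → (¬ HasCycle (remove e E)) ⇔ e ∈ C
uniqueCycle⇒acyclic-remove⇔∈ {E = E} {C} (C-cycle , C⊆E , unique) e = mk⇔ breaks⇒∈ ∈⇒breaks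
  where
  breaks⇒∈ : ¬ HasCycle (remove e E) → e ∈ C
  breaks⇒∈ acyclic with e ∈? C
  ... | yes e∈C = e∈C
  ... | no e∉C  = ⊥-elim (acyclic (hasCycle-remove C-cycle C⊆E e∉C))

  ∈⇒breaks : e ∈ C → ¬ HasCycle (remove e E)
  ∈⇒breaks e∈C (D , D-cycle , D⊆E∖e) =
    proj₂ (∈-remove⁻ e E (D⊆E∖e (proj₂ D≐C e∈C))) refl
    where
    D≐C : D ≐ C
    D≐C = unique D D-cycle (proj₁ ∘ ∈-remove⁻ e E ∘ D⊆E∖e)

criticalEdges : (EdgeSet n → Bool) → EdgeSet n → EdgeSet n
criticalEdges ind E = collect E (map (λ e → ind (remove e E)) E)

∈-collect⁻ : (g : Edge n → Bool) (es : EdgeSet n) →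
  ∀ {e} → e ∈ collect es (map g es) → e ∈ es × g e ≡ true
∈-collect⁻ g (x ∷ xs) h with g x in gx
∈-collect⁻ g (x ∷ xs) (here refl) | true = here refl , gx
∈-collect⁻ g (x ∷ xs) (there h)   | true = map₁ there (∈-collect⁻ g xs h)
∈-collect⁻ g (x ∷ xs) h           | false = map₁ there (∈-collect⁻ g xs h)

∈-collect⁺ : (g : Edge n → Bool) (es : EdgeSet n) →
  ∀ {e} → e ∈ es → g e ≡ true → e ∈ collect es (map g es)
∈-collect⁺ g (x ∷ xs) (here refl) gx rewrite gx = here refl
∈-collect⁺ g (x ∷ xs) (there h) ge with g x
... | true  = there (∈-collect⁺ g xs h ge)
... | false = ∈-collect⁺ g xs h ge

nonEmpty-nothing : {S : EdgeSet n} → (∀ {e} → e ∉ S) → nonEmpty S ≡ nothing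
nonEmpty-nothing {S = []}    _     = refl
nonEmpty-nothing {S = _ ∷ _} empty = ⊥-elim (empty (here refl))

nonEmpty-just : ∀ {S : EdgeSet n} {e} → e ∈ S → nonEmpty S ≡ just S
nonEmpty-just (here _)  = refl
nonEmpty-just (there _) = refl

module _ {ind : EdgeSet n → Bool} (isInd : IsIndOracle ind) (E : EdgeSet n) where

  removalAnswers : List Bool
  removalAnswers = map (λ e → ind (remove e E)) E

  detect-unfold : detectSingleCycle ind E ≡ decide E (ind E ∷ removalAnswers)
  detect-unfold = cong (λ bs → decide E (ind E ∷ bs)) (sym (map-∘ E))

  detect-acyclic : ¬ HasCycle E → detectSingleCycle ind E ≡ nothing
  detect-acyclic acyclic =
    trans detect-unfold (cong (λ b → decide E (b ∷ removalAnswers)) (from (isInd E) acyclic))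

  detect-cyclic : HasCycle E → detectSingleCycle ind E ≡ nonEmpty (criticalEdges ind E)
  detect-cyclic cyclic =
    trans detect-unfold
      (cong (λ b → decide E (b ∷ removalAnswers)) (¬-not λ t → to (isInd E) t cyclic))

  ∈-criticalEdges⁻ : ∀ {e} → e ∈ criticalEdges ind E → e ∈ E × ¬ HasCycle (remove e E)
  ∈-criticalEdges⁻ h = map₂ (to (isInd _)) (∈-collect⁻ _ E h)

  ∈-criticalEdges⁺ : ∀ {e} → e ∈ E → ¬ HasCycle (remove e E) → e ∈ criticalEdges ind E
  ∈-criticalEdges⁺ e∈E acyclic = ∈-collect⁺ _ E e∈E (from (isInd _) acyclic)

  detect-twoCycles : HasTwoCycles E → detectSingleCycle ind E ≡ nothing
  detect-twoCycles two@(C , _ , C-cycle , C⊆E , _) =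
    trans (detect-cyclic (C , C-cycle , C⊆E)) (nonEmpty-nothing λ h →
      proj₂ (∈-criticalEdges⁻ h) (hasTwoCycles⇒hasCycle-remove two _))

  ∈-criticalEdges⇔ : ∀ {C} → UniqueCycle E C → ∀ e → e ∈ criticalEdges ind E ⇔ e ∈ C
  ∈-criticalEdges⇔ unique@(_ , C⊆E , _) e = mk⇔
    (to (uniqueCycle⇒acyclic-remove⇔∈ unique e) ∘ proj₂ ∘ ∈-criticalEdges⁻)
    (λ e∈C → ∈-criticalEdges⁺ (C⊆E e∈C) (from (uniqueCycle⇒acyclic-remove⇔∈ unique e) e∈C))

  detect-uniqueCycle : ∀ {C} → UniqueCycle E C →
    detectSingleCycle ind E ≡ just (criticalEdges ind E)
  detect-uniqueCycle unique@(C-cycle , C⊆E , _) =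
    trans (detect-cyclic (_ , C-cycle , C⊆E))
      (nonEmpty-just (from (∈-criticalEdges⇔ unique _) (proj₂ (cycle-nonempty C-cycle))))

mainTheorem8 : ∀ {n : ℕ} (E : EdgeSet n) → IsSimpleEdgeSet E →
    length (queries E) ≡ suc (length E) ×
    (∀ (ind : EdgeSet n → Bool) → IsIndOracle ind →
      ((¬ HasCycle E ⊎ HasTwoCycles E) → detectSingleCycle ind E ≡ nothing) ×
      (∀ C → UniqueCycle E C →
        ∃[ S ] (detectSingleCycle ind E ≡ just S × S ⊆ E × (∀ e → (e ∈ S) ⇔ (e ∈ C)))))
mainTheorem8 E _ = cong suc (length-map _ E) , λ ind isInd →
  [ detect-acyclic isInd E , detect-twoCycles isInd E ] ,
  λ C unique →
    criticalEdges ind E ,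
    detect-uniqueCycle isInd E unique ,
    proj₁ ∘ ∈-criticalEdges⁻ isInd E ,
    ∈-criticalEdges⇔ isInd E unique
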